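{- Let $\mathcal{C}$ be a left sum-generating class. If $A \in \mathcal{C}$ and $B \in \mathcal{C}^\perp$, then $B + A$ belongs to $\mathcal{C}$ or to $\mathcal{C}^\perp$.
   Context: A class $\mathcal{C}$ of linear orders is left sum-generating if: (i) it is closed under isomorphism; (ii) $A + B \in \mathcal{C}$ implies $B \in \mathcal{C}$; (iii) if $\beta$ is an ordinal and $A_\alpha \in \mathcal{C}$ for all $\alpha<\beta$, then $\sum_{\alpha<\beta} A_\alpha \in \mathcal{C}$. $\mathcal{C}^\perp$ is the class of linear orders having no non-empty initial segment in $\mathcal{C}$. $+$ is the usual ordered sum. -}

module Defs where

open import Level using (0ℓ) renaming (suc to lsuc)
open import Data.Product using (Σ; Σ-syntax; ∃; ∃₂; _×_; _,_; proj₁; proj₂)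
open import Data.Sum using (_⊎_; inj₁; inj₂)
open import Data.Empty using (⊥)
open import Relation.Nullary using (¬_)
open import Relation.Binary.PropositionalEquality using (_≡_; refl; cong)
open import Induction.WellFounded using (WellFounded)

record LinOrd : Set₁ where
  field
    Carrier : Set
    _<_     : Carrier → Carrier → Set
    irrefl  : ∀ x → ¬ (x < x)
    trans   : ∀ {x y z} → x < y → y < z → x < z
    trichot : ∀ x y → x < y ⊎ (x ≡ y ⊎ y < x)

open LinOrd public

record _≅_ (A B : LinOrd) : Set where
  field
    to       : Carrier A → Carrier B
    from     : Carrier B → Carrier A
    from-to  : ∀ x → from (to x) ≡ x
    to-from  : ∀ y → to (from y) ≡ y
    pres     : ∀ {x y} → _<_ A x y → _<_ B (to x) (to y)
    refl<    : ∀ {x y} → _<_ B (to x) (to y) → _<_ A x y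

data _⊕<_ (A B : LinOrd) : (Carrier A ⊎ Carrier B) → (Carrier A ⊎ Carrier B) → Set where
  ll : ∀ {x y} → _<_ A x y → _⊕<_ A B (inj₁ x) (inj₁ y)
  rr : ∀ {x y} → _<_ B x y → _⊕<_ A B (inj₂ x) (inj₂ y)
  lr : ∀ {x y} → _⊕<_ A B (inj₁ x) (inj₂ y)

_+ₗ_ : LinOrd → LinOrd → LinOrd
A +ₗ B = record
  { Carrier = Carrier A ⊎ Carrier B
  ; _<_     = _⊕<_ A B
  ; irrefl  = irr
  ; trans   = tr
  ; trichot = tri
  }
  where
  irr : ∀ x → ¬ (_⊕<_ A B x x)
  irr (inj₁ x) (ll p) = irrefl A x p
  irr (inj₂ x) (rr p) = irrefl B x p
  tr : ∀ {x y z} → _⊕<_ A B x y → _⊕<_ A B y z → _⊕<_ A B x z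
  tr (ll p) (ll q) = ll (trans A p q)
  tr (ll p) lr     = lr
  tr (rr p) (rr q) = rr (trans B p q)
  tr lr (rr q)     = lr
  tri : ∀ x y → _⊕<_ A B x y ⊎ (x ≡ y ⊎ _⊕<_ A B y x)
  tri (inj₁ x) (inj₂ y) = inj₁ lr
  tri (inj₂ x) (inj₁ y) = inj₂ (inj₂ lr)
  tri (inj₁ x) (inj₁ y) with trichot A x y
  ... | inj₁ p          = inj₁ (ll p)
  ... | inj₂ (inj₁ e)   = inj₂ (inj₁ (cong inj₁ e))
  ... | inj₂ (inj₂ p)   = inj₂ (inj₂ (ll p))
  tri (inj₂ x) (inj₂ y) with trichot B x y
  ... | inj₁ p          = inj₁ (rr p)
  ... | inj₂ (inj₁ e)   = inj₂ (inj₁ (cong inj₂ e))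
  ... | inj₂ (inj₂ p)   = inj₂ (inj₂ (rr p))

record Ordinal : Set₁ where
  field
    order : LinOrd
    wf    : WellFounded (_<_ order)

open Ordinal public

-- "L is (isomorphic to) the ordered sum Σ_{α<β} A α".
-- ι α embeds the α-th summand; the summands jointly cover L,
-- each summand is embedded order-preservingly and earlier summands
-- lie entirely below later ones. For linear orders this determines L
-- up to isomorphism as the lexicographic sum.
record IsOrdSum (β : Ordinal) (A : Carrier (order β) → LinOrd) (L : LinOrd) : Set where
  field
    ι       : (α : Carrier (order β)) → Carrier (A α) → Carrier L
    cover   : ∀ x → Σ (Carrier (order β)) (λ α → Σ (Carrier (A α)) (λ a → ι α a ≡ x))
    within  : ∀ α {a a'} → _<_ (A α) a a' → _<_ L (ι α a) (ι α a')
    between : ∀ {α α'} (a : Carrier (A α)) (a' : Carrier (A α')) →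
              _<_ (order β) α α' → _<_ L (ι α a) (ι α' a')

Class : Set₂
Class = LinOrd → Set₁

record LeftSumGenerating (𝒞 : Class) : Set₂ where
  field
    iso-closed : ∀ {A B} → A ≅ B → 𝒞 A → 𝒞 B
    right-summand : ∀ A B → 𝒞 (A +ₗ B) → 𝒞 B
    ordinal-sums : ∀ (β : Ordinal) (A : Carrier (order β) → LinOrd) (L : LinOrd) →
                   (∀ α → 𝒞 (A α)) → IsOrdSum β A L → 𝒞 L

record InitialSegment (L : LinOrd) : Set₁ where
  field
    mem      : Carrier L → Set
    mem-prop : ∀ x (p q : mem x) → p ≡ q
    down     : ∀ {x y} → _<_ L y x → mem x → mem y

open InitialSegment public

restrict : (L : LinOrd) → InitialSegment L → LinOrd
restrict L I = record
  { Carrier = Σ (Carrier L) (mem I)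
  ; _<_     = λ x y → _<_ L (proj₁ x) (proj₁ y)
  ; irrefl  = λ x → irrefl L (proj₁ x)
  ; trans   = trans L
  ; trichot = tri
  }
  where
  tri : ∀ x y → _<_ L (proj₁ x) (proj₁ y) ⊎ (x ≡ y ⊎ _<_ L (proj₁ y) (proj₁ x))
  tri (x , p) (y , q) with trichot L x y
  ... | inj₁ r        = inj₁ r
  ... | inj₂ (inj₂ r) = inj₂ (inj₂ r)
  ... | inj₂ (inj₁ refl) with mem-prop I x p q
  ...   | refl = inj₂ (inj₁ refl)

_⊥ : Class → Class
(𝒞 ⊥) L = ¬ (Σ (InitialSegment L) λ I → Σ (Carrier L) (mem I) × 𝒞 (restrict L I))

{-# OPTIONS --safe #-}
-- If a non-empty initial segment I of B + A lies in 𝒞, it cannot lie inside B (as B ∈ 𝒞^⊥),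
-- so it meets A and therefore contains all of B.  Then A splits as (A ∩ I) + (A ∖ I), whence
-- A ∖ I ∈ 𝒞 by closure under right summands, and B + A = I + (A ∖ I) is a sum of two members
-- of 𝒞 indexed by the ordinal 2.  Excluded middle decides membership in I, which is what makes
-- these splittings possible.
module Submission where

open import Defs
open import Data.Sum using (_⊎_)
open import Axiom.ExcludedMiddle using (ExcludedMiddle)
open import Level using (0ℓ) renaming (suc to lsuc)

open import Level using (lift; lower)
open import Data.Bool using (Bool; true; false; if_then_else_; f<t)
  renaming (_<_ to _<ᵇ_)
open import Data.Bool.Properties using (<-wellFounded)
open import Data.Empty using (⊥-elim)
open import Data.Product using (Σ; _,_; proj₁; _×_)
open import Data.Sum using (inj₁; inj₂)
open import Relation.Nullary using (Dec; yes; no; ¬_)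
open import Relation.Nullary.Decidable using (map′)
open import Relation.Binary.PropositionalEquality using (_≡_; refl; sym; cong; subst₂)

decide : ExcludedMiddle (lsuc 0ℓ) → (P : Set) → Dec P
decide em P = map′ lower lift em

≅-sym : ∀ {A B} → A ≅ B → B ≅ A
≅-sym {A} {B} A≅B = record
  { to      = from
  ; from    = to
  ; from-to = to-from
  ; to-from = from-to
  ; pres    = λ {x} {y} x<y → refl< (subst₂ (_<_ B) (sym (to-from x)) (sym (to-from y)) x<y)
  ; refl<   = λ {x} {y} x<y → subst₂ (_<_ B) (to-from x) (to-from y) (pres x<y)
  }
  where open _≅_ A≅B

𝟚 : Ordinal
𝟚 = record
  { order = record
    { Carrier = Bool
    ; _<_     = _<ᵇ_
    ; irrefl  = λ { _ () }
    ; trans   = λ { f<t () }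
    ; trichot = trichot𝟚
    }
  ; wf = <-wellFounded
  }
  where
  trichot𝟚 : ∀ x y → x <ᵇ y ⊎ (x ≡ y ⊎ y <ᵇ x)
  trichot𝟚 false false = inj₂ (inj₁ refl)
  trichot𝟚 false true  = inj₁ f<t
  trichot𝟚 true  false = inj₂ (inj₂ f<t)
  trichot𝟚 true  true  = inj₂ (inj₁ refl)

+ₗ-isOrdSum : ∀ P Q → IsOrdSum 𝟚 (λ b → if b then Q else P) (P +ₗ Q)
+ₗ-isOrdSum P Q = record { ι = ι ; cover = cover ; within = within ; between = between }
  where
  ι : ∀ b → Carrier (if b then Q else P) → Carrier (P +ₗ Q)
  ι false = inj₁
  ι true  = inj₂
  cover : ∀ x → Σ Bool λ b → Σ (Carrier (if b then Q else P)) λ a → ι b a ≡ x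
  cover (inj₁ p) = false , p , refl
  cover (inj₂ q) = true , q , refl
  within : ∀ b {a a'} → _<_ (if b then Q else P) a a' → _<_ (P +ₗ Q) (ι b a) (ι b a')
  within false = ll
  within true  = rr
  between : ∀ {b b'} a a' → b <ᵇ b' → _<_ (P +ₗ Q) (ι b a) (ι b' a')
  between _ _ f<t = lr

+ₗ-closed : ∀ {𝒞} → LeftSumGenerating 𝒞 → ∀ {P Q} → 𝒞 P → 𝒞 Q → 𝒞 (P +ₗ Q)
+ₗ-closed {𝒞} G {P} {Q} P∈𝒞 Q∈𝒞 =
  LeftSumGenerating.ordinal-sums G 𝟚 _ (P +ₗ Q) summand∈𝒞 (+ₗ-isOrdSum P Q)
  where
  summand∈𝒞 : ∀ b → 𝒞 (if b then Q else P)
  summand∈𝒞 false = P∈𝒞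
  summand∈𝒞 true  = Q∈𝒞

-- ¬ P is judgementally proof-irrelevant (the library's ⊥ is), so equal points give equal pairs.
_∖_ : (L : LinOrd) → InitialSegment L → LinOrd
L ∖ I = record
  { Carrier = Σ (Carrier L) λ x → ¬ mem I x
  ; _<_     = λ x y → _<_ L (proj₁ x) (proj₁ y)
  ; irrefl  = λ x → irrefl L (proj₁ x)
  ; trans   = trans L
  ; trichot = trichot∖
  }
  where
  trichot∖ : ∀ x y → _<_ L (proj₁ x) (proj₁ y) ⊎ (x ≡ y ⊎ _<_ L (proj₁ y) (proj₁ x))
  trichot∖ (x , _) (y , _) with trichot L x y
  ... | inj₁ x<y         = inj₁ x<y
  ... | inj₂ (inj₁ refl) = inj₂ (inj₁ refl)
  ... | inj₂ (inj₂ y<x)  = inj₂ (inj₂ y<x)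

module _ (L : LinOrd) (I : InitialSegment L) (I? : ∀ x → Dec (mem I x)) where

  private
    side : ∀ x → Dec (mem I x) → Carrier (restrict L I +ₗ (L ∖ I))
    side x (yes x∈I) = inj₁ (x , x∈I)
    side x (no x∉I)  = inj₂ (x , x∉I)

    point : Carrier (restrict L I +ₗ (L ∖ I)) → Carrier L
    point (inj₁ (x , _)) = x
    point (inj₂ (x , _)) = x

    point-side : ∀ x → point (side x (I? x)) ≡ x
    point-side x with I? x
    ... | yes _ = refl
    ... | no _  = refl

    side-point : ∀ y → side (point y) (I? (point y)) ≡ y
    side-point (inj₁ (x , x∈I)) with I? x
    ... | yes x∈I' = cong (λ p → inj₁ (x , p)) (mem-prop I x x∈I' x∈I)
    ... | no x∉I   = ⊥-elim (x∉I x∈I)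
    side-point (inj₂ (x , x∉I)) with I? x
    ... | yes x∈I = ⊥-elim (x∉I x∈I)
    ... | no _    = refl

    side-pres : ∀ {x y} → _<_ L x y → _<_ (restrict L I +ₗ (L ∖ I)) (side x (I? x)) (side y (I? y))
    side-pres {x} {y} x<y with I? x | I? y
    ... | yes _   | yes _   = ll x<y
    ... | yes _   | no _    = lr
    ... | no x∉I  | yes y∈I = ⊥-elim (x∉I (down I x<y y∈I))
    ... | no _    | no _    = rr x<y

    side-refl : ∀ {x y} → _<_ (restrict L I +ₗ (L ∖ I)) (side x (I? x)) (side y (I? y)) → _<_ L x y
    side-refl {x} {y} s<s with I? x | I? y | s<s
    ... | yes _   | yes _  | ll x<y = x<y
    ... | no _    | no _   | rr x<y = x<y
    ... | yes x∈I | no y∉I | lr with trichot L x y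
    ...   | inj₁ x<y         = x<y
    ...   | inj₂ (inj₁ refl) = ⊥-elim (y∉I x∈I)
    ...   | inj₂ (inj₂ y<x)  = ⊥-elim (y∉I (down I y<x x∈I))

  split-≅ : L ≅ (restrict L I +ₗ (L ∖ I))
  split-≅ = record
    { to      = λ x → side x (I? x)
    ; from    = point
    ; from-to = point-side
    ; to-from = side-point
    ; pres    = side-pres
    ; refl<   = side-refl
    }

module _ {L M : LinOrd} (I : InitialSegment (L +ₗ M)) where

  inj₁⁻¹ : InitialSegment L
  inj₁⁻¹ = record
    { mem      = λ x → mem I (inj₁ x)
    ; mem-prop = λ x → mem-prop I (inj₁ x)
    ; down     = λ y<x → down I (ll y<x)
    }

  inj₂⁻¹ : InitialSegment M
  inj₂⁻¹ = record
    { mem      = λ x → mem I (inj₂ x)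
    ; mem-prop = λ x → mem-prop I (inj₂ x)
    ; down     = λ y<x → down I (rr y<x)
    }

  restrict-inj₁⁻¹-≅ : ¬ Σ (Carrier M) (λ m → mem I (inj₂ m)) → restrict (L +ₗ M) I ≅ restrict L inj₁⁻¹
  restrict-inj₁⁻¹-≅ I∩M=∅ = record
    { to      = to
    ; from    = from
    ; from-to = from-to
    ; to-from = λ _ → refl
    ; pres    = pres
    ; refl<   = refl<
    }
    where
    to : Carrier (restrict (L +ₗ M) I) → Carrier (restrict L inj₁⁻¹)
    to (inj₁ x , x∈I) = x , x∈I
    to (inj₂ m , m∈I) = ⊥-elim (I∩M=∅ (m , m∈I))
    from : Carrier (restrict L inj₁⁻¹) → Carrier (restrict (L +ₗ M) I)
    from (x , x∈I) = inj₁ x , x∈I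
    from-to : ∀ x → from (to x) ≡ x
    from-to (inj₁ x , _)   = refl
    from-to (inj₂ m , m∈I) = ⊥-elim (I∩M=∅ (m , m∈I))
    pres : ∀ {x y} → _<_ (restrict (L +ₗ M) I) x y → _<_ (restrict L inj₁⁻¹) (to x) (to y)
    pres {inj₁ _ , _} {inj₁ _ , _}   (ll x<y) = x<y
    pres {_}          {inj₂ m , m∈I} _        = ⊥-elim (I∩M=∅ (m , m∈I))
    refl< : ∀ {x y} → _<_ (restrict L inj₁⁻¹) (to x) (to y) → _<_ (restrict (L +ₗ M) I) x y
    refl< {inj₁ _ , _}   {inj₁ _ , _}   x<y = ll x<y
    refl< {inj₂ m , m∈I} {_}            _   = ⊥-elim (I∩M=∅ (m , m∈I))
    refl< {inj₁ _ , _}   {inj₂ m , m∈I} _   = ⊥-elim (I∩M=∅ (m , m∈I))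

  ∖-inj₂⁻¹-≅ : ∀ {m₀} → mem I (inj₂ m₀) → (M ∖ inj₂⁻¹) ≅ ((L +ₗ M) ∖ I)
  ∖-inj₂⁻¹-≅ m₀∈I = record
    { to      = to
    ; from    = from
    ; from-to = λ _ → refl
    ; to-from = to-from
    ; pres    = λ x<y → rr x<y
    ; refl<   = λ {x} {y} → refl< {x} {y}
    }
    where
    L⊆I : ∀ x → mem I (inj₁ x)
    L⊆I x = down I lr m₀∈I
    to : Carrier (M ∖ inj₂⁻¹) → Carrier ((L +ₗ M) ∖ I)
    to (m , m∉I) = inj₂ m , m∉I
    from : Carrier ((L +ₗ M) ∖ I) → Carrier (M ∖ inj₂⁻¹)
    from (inj₁ x , x∉I) = ⊥-elim (x∉I (L⊆I x))
    from (inj₂ m , m∉I) = m , m∉I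
    to-from : ∀ y → to (from y) ≡ y
    to-from (inj₁ x , x∉I) = ⊥-elim (x∉I (L⊆I x))
    to-from (inj₂ m , m∉I) = refl
    refl< : ∀ {x y} → _<_ ((L +ₗ M) ∖ I) (to x) (to y) → _<_ (M ∖ inj₂⁻¹) x y
    refl< (rr x<y) = x<y

module _ {𝒞 : Class} (G : LeftSumGenerating 𝒞) where
  open LeftSumGenerating G

  meets-right⇒+ₗ∈𝒞 : ∀ {L M} (I : InitialSegment (L +ₗ M)) → (∀ x → Dec (mem I x)) →
                       𝒞 M → 𝒞 (restrict (L +ₗ M) I) → ∀ {m₀} → mem I (inj₂ m₀) → 𝒞 (L +ₗ M)
  meets-right⇒+ₗ∈𝒞 {L} {M} I I? M∈𝒞 I∈𝒞 m₀∈I =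
    iso-closed (≅-sym (split-≅ (L +ₗ M) I I?)) (+ₗ-closed G I∈𝒞 M∖I∈𝒞)
    where
    M∖I∈𝒞 : 𝒞 ((L +ₗ M) ∖ I)
    M∖I∈𝒞 = iso-closed (∖-inj₂⁻¹-≅ I m₀∈I)
              (right-summand _ _ (iso-closed (split-≅ M (inj₂⁻¹ I) (λ m → I? (inj₂ m))) M∈𝒞))

  initial-segment∈𝒞⇒+ₗ∈𝒞 : ExcludedMiddle (lsuc 0ℓ) → ∀ {L M} → (𝒞 ⊥) L → 𝒞 M →
                             (I : InitialSegment (L +ₗ M)) → Σ (Carrier (L +ₗ M)) (mem I) →
                             𝒞 (restrict (L +ₗ M) I) → 𝒞 (L +ₗ M)
  initial-segment∈𝒞⇒+ₗ∈𝒞 em L∈𝒞⊥ M∈𝒞 I (inj₂ m , m∈I) I∈𝒞 =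
    meets-right⇒+ₗ∈𝒞 I (λ x → decide em (mem I x)) M∈𝒞 I∈𝒞 m∈I
  initial-segment∈𝒞⇒+ₗ∈𝒞 em {M = M} L∈𝒞⊥ M∈𝒞 I (inj₁ l , l∈I) I∈𝒞
    with decide em (Σ (Carrier M) λ m → mem I (inj₂ m))
  ... | yes (m , m∈I) = meets-right⇒+ₗ∈𝒞 I (λ x → decide em (mem I x)) M∈𝒞 I∈𝒞 m∈I
  ... | no I∩M=∅      = ⊥-elim (L∈𝒞⊥ (inj₁⁻¹ I , (l , l∈I) , iso-closed (restrict-inj₁⁻¹-≅ I I∩M=∅) I∈𝒞))

mainTheorem7 : ExcludedMiddle (lsuc 0ℓ) → (𝒞 : Class) → LeftSumGenerating 𝒞 →
               (A B : LinOrd) → 𝒞 A → (𝒞 ⊥) B → 𝒞 (B +ₗ A) ⊎ (𝒞 ⊥) (B +ₗ A)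
mainTheorem7 em 𝒞 G A B A∈𝒞 B∈𝒞⊥
  with em {Σ (InitialSegment (B +ₗ A)) λ I → Σ (Carrier (B +ₗ A)) (mem I) × 𝒞 (restrict (B +ₗ A) I)}
... | no B+A∈𝒞⊥           = inj₂ B+A∈𝒞⊥
... | yes (I , x₀∈I , I∈𝒞) = inj₁ (initial-segment∈𝒞⇒+ₗ∈𝒞 G em B∈𝒞⊥ A∈𝒞 I x₀∈I I∈𝒞)
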